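{- Let $H$ be a digraph with at least two vertices and $r\in V(H)$ such that every vertex of $H$ is reachable from $r$, and let $B_r$ be the diblock of $r$ in $H$. Then for every pair of distinct vertices $x,y\in B_r$ there exist a directed path $P_x$ from $r$ to $x$ and a directed path $P_y$ from $r$ to $y$ that intersect only in $r$.
   Context: A vertex $v$ is bi-reachable from $r$ if there exist two internally vertex-disjoint directed paths from $r$ to $v$. The diblock $B_r$ of $r$ in $H$ is the set of all vertices bi-reachable from $r$ together with $r$ and all out-neighbours of $r$. -}

module Defs where

open import Data.Nat using (ℕ)
open import Data.Fin using (Fin)
open import Data.List using (List; []; _∷_)
open import Data.List.Membership.Propositional using (_∈_)
open import Data.List.Relation.Unary.Unique.Propositional using (Unique)
open import Data.Sum using (_⊎_)
open import Data.Product using (Σ; ∃; _×_)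
open import Relation.Binary.PropositionalEquality using (_≡_)
open import Level using (Level; _⊔_; suc)

record Digraph : Set₁ where
  field
    n : ℕ
    E : Fin n → Fin n → Set

module _ (H : Digraph) where
  open Digraph H

  data Walk : Fin n → Fin n → Set where
    [_]  : (a : Fin n) → Walk a a
    _∷⟨_⟩_ : (a : Fin n) {b c : Fin n} → E a b → Walk b c → Walk a c

  vertices : ∀ {a b} → Walk a b → List (Fin n)
  vertices [ a ] = a ∷ []
  vertices (a ∷⟨ _ ⟩ w) = a ∷ vertices w

  record Path (a b : Fin n) : Set where
    constructor path
    field
      walk     : Walk a b
      distinct : Unique (vertices walk)

  _∈P_ : ∀ {a b} → Fin n → Path a b → Set
  z ∈P p = z ∈ vertices (Path.walk p)

  Reachable : Fin n → Fin n → Set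
  Reachable a b = Path a b

  BiReachable : Fin n → Fin n → Set
  BiReachable r v = Σ (Path r v) λ P → Σ (Path r v) λ Q →
    (∀ z → z ∈P P → z ∈P Q → (z ≡ r) ⊎ (z ≡ v))

  InDiblock : Fin n → Fin n → Set
  InDiblock r v = BiReachable r v ⊎ ((v ≡ r) ⊎ E r v)

-- Let x be bi-reachable through internally disjoint paths P₁, P₂, and let Q be an r–y path
-- avoiding x. Follow Q from the last vertex w it shares with P₁ ∪ P₂, say w ∈ P₁; then
-- P₁ up to w followed by Q from w is an r–y path meeting P₂ only in r. Such a Q always
-- exists for one of x, y: an r–y path through x can be cut at x, giving an r–x path
-- avoiding y. Out-neighbours of r are reached by single arcs.
module Submission where

open import Defs
open import Data.Nat using (_≤_)
open import Data.Fin using (Fin; _≟_)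
open import Data.Product using (Σ; _,_; _×_)
open import Data.Sum using (_⊎_; inj₁; inj₂)
open import Data.List using (List; []; _∷_; _++_)
open import Data.List.Membership.Propositional using (_∈_; lose)
open import Data.List.Membership.Propositional.Properties using (∈-++⁺ˡ; ∈-++⁺ʳ; ∈-++⁻)
open import Data.List.Relation.Unary.Any using (Any; here; there; any?)
import Data.List.Relation.Unary.All as All
open import Data.List.Relation.Unary.All.Properties using (++⁻ˡ; ++⁻ʳ)
open import Data.List.Relation.Unary.AllPairs using ([]; _∷_)
open import Data.List.Relation.Unary.Unique.Propositional using (Unique)
open import Data.List.Relation.Unary.Unique.Propositional.Properties using (++⁺)
open import Data.List.Relation.Binary.Disjoint.Propositional using (Disjoint)
open import Data.Empty using (⊥-elim)
open import Relation.Nullary using (¬_; yes; no)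
open import Relation.Nullary.Decidable using (_⊎-dec_)
open import Relation.Unary using (Pred; Decidable)
open import Relation.Binary.PropositionalEquality using (_≡_; _≢_; refl; sym; cong; subst)
import Data.List.Membership.DecPropositional as DecMembership

Unique-++⁻ : ∀ {a} {A : Set a} (xs : List A) {ys : List A} → Unique (xs ++ ys) →
             Unique xs × Unique ys × Disjoint xs ys
Unique-++⁻ []       u          = [] , u , λ { (() , _) }
Unique-++⁻ (x ∷ xs) (x∉ ∷ u) with Unique-++⁻ xs u
... | uxs , uys , xs#ys = ++⁻ˡ xs x∉ ∷ uxs , uys , x∷xs#ys
  where
    x∷xs#ys : Disjoint (x ∷ xs) _
    x∷xs#ys (here refl , v∈ys) = All.lookup (++⁻ʳ xs x∉) v∈ys refl
    x∷xs#ys (there v∈xs , v∈ys) = xs#ys (v∈xs , v∈ys)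

module WalkSplitting (H : Digraph) where
  open Digraph H
  open DecMembership (_≟_ {n}) using (_∈?_)

  infix 4 _∈ₚ_ _∉ₚ_

  _∈ₚ_ : ∀ {a b} → Fin n → Path H a b → Set
  z ∈ₚ P = _∈P_ H z P

  _∉ₚ_ : ∀ {a b} → Fin n → Path H a b → Set
  z ∉ₚ P = ¬ z ∈ₚ P

  first∈ : ∀ {a b} (w : Walk H a b) → a ∈ vertices H w
  first∈ [ a ]        = here refl
  first∈ (a ∷⟨ _ ⟩ _) = here refl

  last∈ : ∀ {a b} (w : Walk H a b) → b ∈ vertices H w
  last∈ [ a ]        = here refl
  last∈ (a ∷⟨ _ ⟩ w) = there (last∈ w)

  trivialPath : ∀ a → Path H a a
  trivialPath a = path [ a ] (All.[] ∷ [])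

  arcPath : ∀ {a b} → a ≢ b → E a b → Path H a b
  arcPath {a} {b} a≢b e =
    path (a ∷⟨ e ⟩ [ b ]) (All.tabulate (λ { (here refl) → a≢b ; (there ()) }) ∷ All.[] ∷ [])

  ∉-arcPath : ∀ {a b z} (a≢b : a ≢ b) (e : E a b) → z ≢ a → z ≢ b → z ∉ₚ arcPath a≢b e
  ∉-arcPath _ _ z≢a _   (here z≡a)         = z≢a z≡a
  ∉-arcPath _ _ _   z≢b (there (here z≡b)) = z≢b z≡b

  -- The vertices of a walk with its final vertex dropped, so that vertex lists of walks
  -- glued at a common vertex concatenate without repetition.
  initVertices : ∀ {a b} → Walk H a b → List (Fin n)
  initVertices [ _ ]        = []
  initVertices (a ∷⟨ _ ⟩ w) = a ∷ initVertices w

  _++ᵂ_ : ∀ {a b c} → Walk H a b → Walk H b c → Walk H a c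
  [ _ ]        ++ᵂ v = v
  (a ∷⟨ e ⟩ w) ++ᵂ v = a ∷⟨ e ⟩ (w ++ᵂ v)

  vertices-++ᵂ : ∀ {a b c} (w : Walk H a b) (v : Walk H b c) →
                 vertices H (w ++ᵂ v) ≡ initVertices w ++ vertices H v
  vertices-++ᵂ [ _ ]        v = refl
  vertices-++ᵂ (a ∷⟨ _ ⟩ w) v = cong (a ∷_) (vertices-++ᵂ w v)

  record Split {a b} (Q : Walk H a b) (w : Fin n) : Set where
    constructor split
    field
      prefix         : Walk H a w
      suffix         : Walk H w b
      vertices-split : vertices H Q ≡ initVertices prefix ++ vertices H suffix

  splitAt : ∀ {a b w} (Q : Walk H a b) → w ∈ vertices H Q → Split Q w
  splitAt [ a ]         (here refl) = split [ a ] [ a ] refl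
  splitAt (a ∷⟨ e ⟩ Q)  (here refl) = split [ a ] (a ∷⟨ e ⟩ Q) refl
  splitAt (a ∷⟨ e ⟩ Q)  (there w∈Q) with splitAt Q w∈Q
  ... | split A B eq = split (a ∷⟨ e ⟩ A) B (cong (a ∷_) eq)

  splitAtLast : ∀ {ℓ} {S : Pred (Fin n) ℓ} → Decidable S → ∀ {a b} (Q : Walk H a b) →
                Any S (vertices H Q) →
                Σ (Fin n) λ w → S w × Σ (Split Q w) λ s →
                  ∀ z → z ∈ vertices H (Split.suffix s) → S z → z ≡ w
  splitAtLast S? [ a ] (here s) = a , s , split [ a ] [ a ] refl , λ { _ (here refl) _ → refl }
  splitAtLast S? (a ∷⟨ e ⟩ Q) s∈ with any? S? (vertices H Q) | s∈
  ... | yes s∈Q | _ with splitAtLast S? Q s∈Q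
  ...   | w , s , split A B eq , lastS = w , s , split (a ∷⟨ e ⟩ A) B (cong (a ∷_) eq) , lastS
  splitAtLast S? (a ∷⟨ e ⟩ Q) s∈ | no s∉Q | there s∈Q = ⊥-elim (s∉Q s∈Q)
  splitAtLast S? (a ∷⟨ e ⟩ Q) s∈ | no s∉Q | here s =
    a , s , split [ a ] (a ∷⟨ e ⟩ Q) refl ,
    λ { _ (here refl) _ → refl ; z (there z∈Q) sz → ⊥-elim (s∉Q (lose z∈Q sz)) }

  record UniqueSplit {a b w} (P : Path H a b) (s : Split (Path.walk P) w) : Set where
    open Split s
    field
      unique-initVertices : Unique (initVertices prefix)
      unique-suffix       : Unique (vertices H suffix)
      disjoint            : Disjoint (initVertices prefix) (vertices H suffix)

  uniqueSplit : ∀ {a b w} (P : Path H a b) (s : Split (Path.walk P) w) → UniqueSplit P s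
  uniqueSplit (path Q uQ) (split A B eq) with Unique-++⁻ (initVertices A) (subst Unique eq uQ)
  ... | uA , uB , A#B = record { unique-initVertices = uA ; unique-suffix = uB ; disjoint = A#B }

  glue : ∀ {a b w c} (P : Path H a b) → w ∈ₚ P → (T : Path H w c) →
         (∀ z → z ∈ₚ P → z ∈ₚ T → z ≡ w) →
         Σ (Path H a c) λ R → ∀ z → z ∈ₚ R → z ∈ₚ T ⊎ (z ∈ₚ P × z ≢ b)
  glue {b = b} P w∈P (path T uT) meetsOnlyAt-w =
    path (A ++ᵂ T) (subst Unique (sym (vertices-++ᵂ A T)) (++⁺ uA uT A#T)) , covered
    where
      s : Split (Path.walk P) _
      s = splitAt (Path.walk P) w∈P
      open Split s renaming (prefix to A; suffix to B)
      open UniqueSplit (uniqueSplit P s) renaming (unique-initVertices to uA; disjoint to A#B)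

      ∈P-prefix : ∀ {z} → z ∈ initVertices A → z ∈ₚ P
      ∈P-prefix z∈A = subst (_ ∈_) (sym vertices-split) (∈-++⁺ˡ z∈A)

      A#T : Disjoint (initVertices A) (vertices H T)
      A#T (z∈A , z∈T) with meetsOnlyAt-w _ (∈P-prefix z∈A) z∈T
      ... | refl = A#B (z∈A , first∈ B)

      covered : ∀ z → z ∈ vertices H (A ++ᵂ T) → z ∈ vertices H T ⊎ (z ∈ₚ P × z ≢ b)
      covered z z∈ with ∈-++⁻ (initVertices A) (subst (z ∈_) (vertices-++ᵂ A T) z∈)
      ... | inj₂ z∈T = inj₁ z∈T
      ... | inj₁ z∈A = inj₂ (∈P-prefix z∈A , λ { refl → A#B (z∈A , last∈ B) })

  DisjointPaths : Fin n → Fin n → Fin n → Set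
  DisjointPaths r x y =
    Σ (Path H r x) λ Px → Σ (Path H r y) λ Py → ∀ z → z ∈ₚ Px → z ∈ₚ Py → z ≡ r

  DisjointPaths-swap : ∀ {r x y} → DisjointPaths r x y → DisjointPaths r y x
  DisjointPaths-swap (Px , Py , meet) = Py , Px , λ z z∈Py z∈Px → meet z z∈Px z∈Py

  DisjointPaths-root : ∀ {r y} → Path H r y → DisjointPaths r r y
  DisjointPaths-root {r} Py = trivialPath r , Py , λ { _ (here refl) _ → refl }

  DisjointPaths-arcs : ∀ {r x y} (r≢x : r ≢ x) (r≢y : r ≢ y) → x ≢ y → E r x → E r y →
                       DisjointPaths r x y
  DisjointPaths-arcs r≢x r≢y x≢y ex ey =
    arcPath r≢x ex , arcPath r≢y ey ,
    λ { _ (here refl) _ → refl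
      ; _ (there (here refl)) (here x≡r) → x≡r
      ; _ (there (here refl)) (there (here x≡y)) → ⊥-elim (x≢y x≡y) }

  -- With w on P₁ and T meeting P₁ ∪ P₂ only in w, the path P₂ and the path P₁[r,w] T are
  -- disjoint: P₁[r,w) avoids P₂ except at r because it misses x, and T only touches P₂ in
  -- w, which is r since w ≠ x.
  DisjointPaths-reroute : ∀ {r x y w} (P₁ P₂ : Path H r x) →
    (∀ z → z ∈ₚ P₁ → z ∈ₚ P₂ → z ≡ r ⊎ z ≡ x) →
    w ∈ₚ P₁ → w ≢ x → (T : Path H w y) →
    (∀ z → z ∈ₚ T → z ∈ₚ P₁ ⊎ z ∈ₚ P₂ → z ≡ w) → DisjointPaths r x y
  DisjointPaths-reroute P₁ P₂ internallyDisjoint w∈P₁ w≢x T meetsOnlyAt-w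
    with glue P₁ w∈P₁ T (λ z z∈P₁ z∈T → meetsOnlyAt-w z z∈T (inj₁ z∈P₁))
  ... | R , covered = P₂ , R , meet
    where
      rootOrX : ∀ {z} → z ∈ₚ P₁ → z ∈ₚ P₂ → z ≢ _ → z ≡ _
      rootOrX z∈P₁ z∈P₂ z≢x with internallyDisjoint _ z∈P₁ z∈P₂
      ... | inj₁ z≡r = z≡r
      ... | inj₂ z≡x = ⊥-elim (z≢x z≡x)

      meet : ∀ z → z ∈ₚ P₂ → z ∈ₚ R → z ≡ _
      meet z z∈P₂ z∈R with covered z z∈R
      ... | inj₂ (z∈P₁ , z≢x) = rootOrX z∈P₁ z∈P₂ z≢x
      ... | inj₁ z∈T with meetsOnlyAt-w z z∈T (inj₂ z∈P₂)
      ...   | refl = rootOrX w∈P₁ z∈P₂ w≢x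

  DisjointPaths-biReachable : ∀ {r x y} → BiReachable H r x → (Q : Path H r y) → x ∉ₚ Q →
                              DisjointPaths r x y
  DisjointPaths-biReachable {r} (P₁ , P₂ , internallyDisjoint) (path Q uQ) x∉Q
    with splitAtLast (λ z → (z ∈? vertices H (Path.walk P₁)) ⊎-dec (z ∈? vertices H (Path.walk P₂)))
                     Q (lose (first∈ Q) (inj₁ (first∈ (Path.walk P₁))))
  ... | w , w∈P , s , lastOnP = reroute w∈P
    where
      open Split s
      T : Path H w _
      T = path suffix (UniqueSplit.unique-suffix (uniqueSplit (path Q uQ) s))

      w≢x : w ≢ _
      w≢x refl = x∉Q (subst (_ ∈_) (sym vertices-split) (∈-++⁺ʳ _ (first∈ suffix)))

      reroute : w ∈ₚ P₁ ⊎ w ∈ₚ P₂ → DisjointPaths r _ _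
      reroute (inj₁ w∈P₁) = DisjointPaths-reroute P₁ P₂ internallyDisjoint w∈P₁ w≢x T lastOnP
      reroute (inj₂ w∈P₂) =
        DisjointPaths-reroute P₂ P₁ (λ z z∈P₂ z∈P₁ → internallyDisjoint z z∈P₁ z∈P₂) w∈P₂ w≢x T
          (λ { z z∈T (inj₁ z∈P₂) → lastOnP z z∈T (inj₂ z∈P₂)
             ; z z∈T (inj₂ z∈P₁) → lastOnP z z∈T (inj₁ z∈P₁) })

  avoidOne : ∀ {r x y} → x ≢ y → Path H r y →
             Σ (Path H r y) (x ∉ₚ_) ⊎ Σ (Path H r x) (y ∉ₚ_)
  avoidOne {x = x} {y} x≢y Q with x ∈? vertices H (Path.walk Q)
  ... | no x∉Q = inj₁ (Q , x∉Q)
  ... | yes x∈Q with glue Q x∈Q (trivialPath x) (λ { _ _ (here z≡x) → z≡x })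
  ...   | R , covered = inj₂ (R , y∉R)
    where
      y∉R : y ∉ₚ R
      y∉R y∈R with covered y y∈R
      ... | inj₁ (here y≡x)  = x≢y (sym y≡x)
      ... | inj₂ (_ , y≢y) = y≢y refl

open WalkSplitting

lemma5 : (H : Digraph) → 2 ≤ Digraph.n H → (r : Fin (Digraph.n H)) →
    (∀ v → Reachable H r v) →
    ∀ x y → InDiblock H r x → InDiblock H r y → ¬ x ≡ y →
    Σ (Path H r x) λ Px → Σ (Path H r y) λ Py →
    (∀ z → _∈P_ H z Px → _∈P_ H z Py → z ≡ r)
lemma5 H _ r reach x y x∈B y∈B x≢y with x ≟ r | y ≟ r
... | yes refl | _        = DisjointPaths-root H (reach y)
... | no _     | yes refl = DisjointPaths-swap H (DisjointPaths-root H (reach x))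
... | no x≢r   | no y≢r   = fromDiblock x∈B y∈B
  where
    r≢x : r ≢ x
    r≢x r≡x = x≢r (sym r≡x)

    r≢y : r ≢ y
    r≢y r≡y = y≢r (sym r≡y)

    fromDiblock : InDiblock H r x → InDiblock H r y → DisjointPaths H r x y
    fromDiblock (inj₂ (inj₁ x≡r)) _ = ⊥-elim (x≢r x≡r)
    fromDiblock _ (inj₂ (inj₁ y≡r)) = ⊥-elim (y≢r y≡r)
    fromDiblock (inj₂ (inj₂ ex)) (inj₂ (inj₂ ey)) = DisjointPaths-arcs H r≢x r≢y x≢y ex ey
    fromDiblock (inj₁ x-bi) (inj₂ (inj₂ ey)) =
      DisjointPaths-biReachable H x-bi (arcPath H r≢y ey) (∉-arcPath H r≢y ey x≢r x≢y)
    fromDiblock (inj₂ (inj₂ ex)) (inj₁ y-bi) =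
      DisjointPaths-swap H (DisjointPaths-biReachable H y-bi (arcPath H r≢x ex)
        (∉-arcPath H r≢x ex y≢r (λ y≡x → x≢y (sym y≡x))))
    fromDiblock (inj₁ x-bi) (inj₁ y-bi) with avoidOne H x≢y (reach y)
    ... | inj₁ (Q , x∉Q) = DisjointPaths-biReachable H x-bi Q x∉Q
    ... | inj₂ (Q , y∉Q) = DisjointPaths-swap H (DisjointPaths-biReachable H y-bi Q y∉Q)
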